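{- Let $\Phi=(\Gamma,C,X,Y_0,Y_1,A_1,\Delta,\Lambda)$ be a reduced frame template over a finite field $\mathbb{F}$ that is not refined. If $M\in\mathcal{M}(\Phi)$, then $E(M)-Y_0$ is not spanning in $M$.
   Context: Let $\mathbb{F}$ be a finite field of characteristic $p$ with prime subfield $\mathbb{F}_p$ and multiplicative group $\mathbb{F}^\times$. For disjoint $A,B$, identify $\mathbb{F}^A\times\mathbb{F}^B$ with $\mathbb{F}^{A\cup B}$; for $U\subseteq\mathbb{F}^E$ and $X\subseteq E$, $U[X]$ is the set of coordinate projections onto $X$ of vectors in $U$; $\Gamma U=\{\gamma u:\gamma\in\Gamma,u\in U\}$; additive subgroups $U,W$ are skew if $U\cap W=\{0\}$. A frame matrix has at most two nonzero entries per column; for $\Gamma\le\mathbb{F}^\times$, a $\Gamma$-frame matrix is a frame matrix in which each nonzero column contains a $1$ and any second nonzero entry equals $-\gamma$ for some $\gamma\in\Gamma$. A frame template is a tuple $\Phi=(\Gamma,C,X,Y_0,Y_1,A_1,\Delta,\Lambda)$ with $\Gamma\le\mathbb{F}^\times$; $C,X,Y_0,Y_1$ disjoint finite sets; $A_1\in\mathbb{F}^{X\times(C\cup Y_0\cup Y_1)}$; $\Lambda$ an additive subgroup of $\mathbb{F}^X$ closed under scaling by $\Gamma$; $\Delta$ an additive subgroup of $\mathbb{F}^{C\cup Y_0\cup Y_1}$ closed under scaling by $\Gamma$. A matrix $A'\in\mathbb{F}^{B\times E}$ respects $\Phi$ if $X\subseteq B$, $C,Y_0,Y_1\subseteq E$,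 $A'[X,C\cup Y_0\cup Y_1]=A_1$, and there is $Z\subseteq E-(C\cup Y_0\cup Y_1)$ with $A'[X,Z]=0$, each column of $A'[B-X,Z]$ a unit vector, $A'[B-X,E-(C\cup Y_0\cup Y_1\cup Z)]$ a $\Gamma$-frame matrix, each column of $A'[X,E-(C\cup Y_0\cup Y_1\cup Z)]$ in $\Lambda$, and each row of $A'[B-X,C\cup Y_0\cup Y_1]$ in $\Delta$. A matrix $A$ conforms to $\Phi$ if for some such $A'$ and $Z$, $A[B,E-Z]=A'[B,E-Z]$ and for each $i\in Z$ there is $j\in Y_1$ such that column $i$ of $A$ is the sum of columns $i$ and $j$ of $A'$. $\mathcal{M}(\Phi)$ is the set of $\mathbb{F}$-represented matroids isomorphic to $M(A)/C\backslash Y_1$ for some $A$ conforming to $\Phi$. $\Phi$ is reduced if there is a partition $(X_0,X_1)$ of $X$ (a reduction partition) such that $\Delta=\Gamma(\mathbb{F}_p^C\times\Delta')$ for some additive subgroup $\Delta'$ of $\mathbb{F}^{Y_0\cup Y_1}$; $\mathbb{F}_p^{X_0}\subseteq\Lambda[X_0]$, $\Lambda[X_1]=\{0\}$ and $A_1[X_1,C]=0$; and the rows of $A_1[X_1,C\cup Y_0\cup Y_1]$ form a basis for a subspace whose additive group is skew to $\Delta$. $\Phi$ is refined if it is reduced, with reduction partition $(X_0,X_1)$, and $Y_1$ spans the matroid $M(A_1[X_1,Y_0\cup Y_1])$. -}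

module Defs where

open import Level using (0ℓ)
open import Algebra.Bundles using (CommutativeRing)
open import Data.Nat using (ℕ; zero; suc)
open import Data.Fin using (Fin)
open import Data.Bool using (Bool; true; false)
open import Data.Sum using (_⊎_; inj₁; inj₂)
open import Data.Product using (Σ; ∃; _×_; _,_)
open import Data.Empty using (⊥)
open import Data.Unit using (⊤)
open import Relation.Nullary using (¬_)
open import Relation.Binary.Definitions using (Decidable)
open import Relation.Binary.PropositionalEquality using (_≡_; _≢_)

record FiniteField : Set₁ where
  field
    commRing : CommutativeRing 0ℓ 0ℓ
  open CommutativeRing commRing public
  field
    1≉0      : ¬ (1# ≈ 0#)
    inverse  : ∀ a → ¬ (a ≈ 0#) → ∃ λ b → a * b ≈ 1#
    size     : ℕ
    enum     : Fin size → Carrier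
    enumSurj : ∀ a → ∃ λ i → enum i ≈ a
    _≟_      : Decidable _≈_

module _ (𝔽 : FiniteField) where
  open FiniteField 𝔽

  sumFin : ∀ {n} → (Fin n → Carrier) → Carrier
  sumFin {zero}  f = 0#
  sumFin {suc n} f = f Fin.zero + sumFin (λ i → f (Fin.suc i))

  natF : ℕ → Carrier
  natF zero    = 0#
  natF (suc k) = 1# + natF k

  InPrimeSubfield : Carrier → Set
  InPrimeSubfield a = ∃ λ k → a ≈ natF k

  IsMulSubgroup : (Carrier → Set) → Set
  IsMulSubgroup Γ =
    (∀ a b → a ≈ b → Γ a → Γ b) ×
    (∀ a → Γ a → ¬ (a ≈ 0#)) ×
    Γ 1# ×
    (∀ a b → Γ a → Γ b → Γ (a * b)) ×
    (∀ a → Γ a → ∃ λ b → Γ b × (a * b ≈ 1#))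

  IsAdditiveSubgroup : {I : Set} → ((I → Carrier) → Set) → Set
  IsAdditiveSubgroup {I} U =
    (∀ u v → (∀ i → u i ≈ v i) → U u → U v) ×
    U (λ _ → 0#) ×
    (∀ u v → U u → U v → U (λ i → u i + v i)) ×
    (∀ u → U u → U (λ i → - u i))

  IsΓClosed : {I : Set} → (Carrier → Set) → ((I → Carrier) → Set) → Set
  IsΓClosed Γ U = ∀ γ u → Γ γ → U u → U (λ i → γ * u i)

  IsUnitVector : ∀ {n} → (Fin n → Carrier) → Set
  IsUnitVector col = Σ _ λ r → (col r ≈ 1#) × (∀ r' → r' ≢ r → col r' ≈ 0#)

  IsΓFrameColumn : ∀ {n} → (Carrier → Set) → (Fin n → Carrier) → Set
  IsΓFrameColumn Γ col =
    (∀ r → col r ≈ 0#) ⊎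
    (IsUnitVector col ⊎
     Σ _ λ r₁ → Σ _ λ r₂ → (r₁ ≢ r₂) × (col r₁ ≈ 1#) ×
       (∃ λ γ → Γ γ × (col r₂ ≈ - γ)) ×
       (∀ r' → r' ≢ r₁ → r' ≢ r₂ → col r' ≈ 0#))

-- Frame templates.  C, X, Y₀, Y₁ are the finite sets Fin c, Fin x, Fin y₀,
-- Fin y₁; C ∪ Y₀ ∪ Y₁ is the disjoint union K = Fin c ⊎ (Fin y₀ ⊎ Fin y₁).

K : ℕ → ℕ → ℕ → Set
K c y₀ y₁ = Fin c ⊎ (Fin y₀ ⊎ Fin y₁)

record Template (𝔽 : FiniteField) : Set₁ where
  open FiniteField 𝔽
  field
    c x y₀ y₁ : ℕ
    Γ  : Carrier → Set
    A₁ : Fin x → K c y₀ y₁ → Carrier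
    Δ  : (K c y₀ y₁ → Carrier) → Set
    Λ  : (Fin x → Carrier) → Set
    Γ-subgroup : IsMulSubgroup 𝔽 Γ
    Λ-subgroup : IsAdditiveSubgroup 𝔽 Λ
    Λ-Γclosed  : IsΓClosed 𝔽 Γ Λ
    Δ-subgroup : IsAdditiveSubgroup 𝔽 Δ
    Δ-Γclosed  : IsΓClosed 𝔽 Γ Δ

module _ {𝔽 : FiniteField} (Φ : Template 𝔽) where
  open FiniteField 𝔽
  open Template Φ

  Kₜ : Set
  Kₜ = K c y₀ y₁

  -- a partition (X₀, X₁) of X is encoded by P : Fin x → Bool,
  -- X₁ = {i | P i ≡ true}, X₀ = {i | P i ≡ false}.

  sel : Bool → Carrier → Carrier
  sel true  a = a
  sel false a = 0#

  rowComb : (Fin x → Bool) → (Fin x → Carrier) → Kₜ → Carrier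
  rowComb P a k = sumFin 𝔽 (λ i → sel (P i) (a i * A₁ i k))

  IsReductionPartition : (Fin x → Bool) → Set₁
  IsReductionPartition P =
    -- Δ = Γ(𝔽_p^C × Δ') for some additive subgroup Δ' of 𝔽^(Y₀ ∪ Y₁)
    (Σ ((Fin y₀ ⊎ Fin y₁ → Carrier) → Set) λ Δ' →
       IsAdditiveSubgroup 𝔽 Δ' ×
       (∀ v → Δ v →
          ∃ λ γ → ∃ λ (u : Kₜ → Carrier) → Γ γ ×
            (∀ k → InPrimeSubfield 𝔽 (u (inj₁ k))) ×
            Δ' (λ j → u (inj₂ j)) × (∀ k → v k ≈ γ * u k)) ×
       (∀ γ (u : Kₜ → Carrier) → Γ γ →
            (∀ k → InPrimeSubfield 𝔽 (u (inj₁ k))) →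
            Δ' (λ j → u (inj₂ j)) → Δ (λ k → γ * u k))) ×
    (∀ (w : Fin x → Carrier) → (∀ i → P i ≡ false → InPrimeSubfield 𝔽 (w i)) →
       ∃ λ l → Λ l × (∀ i → P i ≡ false → l i ≈ w i)) ×
    (∀ l → Λ l → ∀ i → P i ≡ true → l i ≈ 0#) ×
    (∀ i k → P i ≡ true → A₁ i (inj₁ k) ≈ 0#) ×
    (∀ a → (∀ k → rowComb P a k ≈ 0#) → ∀ i → P i ≡ true → a i ≈ 0#) ×
    (∀ a → Δ (rowComb P a) → ∀ k → rowComb P a k ≈ 0#)

  IsReduced : Set₁
  IsReduced = Σ (Fin x → Bool) IsReductionPartition

  -- Y₁ spans M(A₁[X₁, Y₀ ∪ Y₁]): every column indexed by Y₀ (restricted to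
  -- the rows X₁) is a linear combination of the columns indexed by Y₁.
  Y₁Spans : (Fin x → Bool) → Set
  Y₁Spans P = ∀ (j : Fin y₀) → ∃ λ (μ : Fin y₁ → Carrier) →
    ∀ i → P i ≡ true →
      A₁ i (inj₂ (inj₁ j)) ≈ sumFin 𝔽 (λ t → μ t * A₁ i (inj₂ (inj₂ t)))

  IsRefined : Set₁
  IsRefined = Σ (Fin x → Bool) λ P → IsReductionPartition P × Y₁Spans P

  -- Matrices respecting / conforming to Φ.  Rows B = X ⊎ Fin b,
  -- columns E = (C ∪ Y₀ ∪ Y₁) ⊎ Fin e.  Z ⊆ Fin e is given by Z : Fin e → Bool.

  Rows : ℕ → Set
  Rows b = Fin x ⊎ Fin b

  Cols : ℕ → Set
  Cols e = Kₜ ⊎ Fin e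

  Matrix : ℕ → ℕ → Set
  Matrix b e = Rows b → Cols e → Carrier

  RespectsWith : ∀ {b e} → Matrix b e → (Fin e → Bool) → Set
  RespectsWith A' Z =
    (∀ i k → A' (inj₁ i) (inj₁ k) ≈ A₁ i k) ×
    (∀ i z → Z z ≡ true → A' (inj₁ i) (inj₂ z) ≈ 0#) ×
    (∀ z → Z z ≡ true → IsUnitVector 𝔽 (λ r → A' (inj₂ r) (inj₂ z))) ×
    (∀ z → Z z ≡ false → IsΓFrameColumn 𝔽 Γ (λ r → A' (inj₂ r) (inj₂ z))) ×
    (∀ z → Z z ≡ false → Λ (λ i → A' (inj₁ i) (inj₂ z))) ×
    (∀ r → Δ (λ k → A' (inj₂ r) (inj₁ k)))

  Conforms : ∀ {b e} → Matrix b e → Set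
  Conforms {b} {e} A = Σ (Matrix b e) λ A' → Σ (Fin e → Bool) λ Z →
    RespectsWith A' Z ×
    (∀ r k → A r (inj₁ k) ≈ A' r (inj₁ k)) ×
    (∀ r z → Z z ≡ false → A r (inj₂ z) ≈ A' r (inj₂ z)) ×
    (∀ z → Z z ≡ true → ∃ λ (j : Fin y₁) →
       ∀ r → A r (inj₂ z) ≈ A' r (inj₂ z) + A' r (inj₁ (inj₂ (inj₂ j))))

  isC isY₀ isY₁ : ∀ {e} → Cols e → Set
  isC (inj₁ (inj₁ _)) = ⊤
  isC _ = ⊥
  isY₀ (inj₁ (inj₂ (inj₁ _))) = ⊤
  isY₀ _ = ⊥
  isY₁ (inj₁ (inj₂ (inj₂ _))) = ⊤
  isY₁ _ = ⊥

  sumCols : ∀ {e} → (Cols e → Carrier) → Carrier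
  sumCols f = (sumFin 𝔽 (λ k → f (inj₁ (inj₁ k))) +
               (sumFin 𝔽 (λ k → f (inj₁ (inj₂ (inj₁ k)))) +
                sumFin 𝔽 (λ k → f (inj₁ (inj₂ (inj₂ k))))))
              + sumFin 𝔽 (λ k → f (inj₂ k))

  InColSpan : ∀ {b e} → Matrix b e → (Cols e → Set) → (Rows b → Carrier) → Set
  InColSpan {b} {e} A T v = ∃ λ (μ : Cols e → Carrier) →
    (∀ f → ¬ T f → μ f ≈ 0#) × (∀ r → v r ≈ sumCols (λ f → μ f * A r f))

  -- For M = M(A)/C\Y₁ (ground set E − (C ∪ Y₁)), a set S ⊆ E(M) is spanning
  -- in M iff every column in E − (C ∪ Y₁) is in the span of the columns in S ∪ C.
  SpanningInMinor : ∀ {b e} → Matrix b e → (Cols e → Set) → Set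
  SpanningInMinor A S =
    ∀ f → ¬ isC f → ¬ isY₁ f → InColSpan A (λ g → S g ⊎ isC g) (λ r → A r f)

  GroundMinusY₀ : ∀ {e} → Cols e → Set
  GroundMinusY₀ f = ¬ isC f × ¬ isY₀ f × ¬ isY₁ f

{-# OPTIONS --safe #-}
-- Suppose E(M) − Y₀ spans M, and let (X₀, X₁) be a reduction partition. Each Y₀-column of A is
-- then a combination of the C-columns and the columns outside C ∪ Y₀ ∪ Y₁. On the rows X₁ the
-- C-columns vanish (A₁[X₁, C] = 0), so do the other columns outside Z (their X-part lies in Λ
-- and Λ[X₁] = {0}), and a column in Z agrees with some Y₁-column of A₁. Hence every column of
-- A₁[X₁, Y₀] lies in the span of A₁[X₁, Y₁], so the same partition makes Φ refined.
module Submission where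

open import Defs
open import Data.Nat using (ℕ; zero; suc)
open import Relation.Nullary using (¬_)
open import Data.Fin using (Fin; zero; suc)
open import Data.Bool using (Bool; true; false)
open import Data.Sum using (_⊎_; inj₁; inj₂)
open import Data.Product using (∃; _,_)
open import Data.Vec.Functional using (Vector)
open import Function using (_∘_)
open import Data.Unit using (tt)
open import Relation.Binary.PropositionalEquality as ≡ using (_≡_)
import Algebra.Properties.Semiring.Sum as SemiringSum
import Relation.Binary.Reasoning.Setoid as SetoidReasoning

module _ (𝔽 : FiniteField) where
  open FiniteField 𝔽 hiding (zero)
  open SemiringSum semiring using (sum; sum-cong-≋; sum-replicate-zero; ∑-distrib-+; *-distribˡ-sum)
  open SetoidReasoning setoid

  sumFin≡sum : ∀ {n} (f : Vector Carrier n) → sumFin 𝔽 f ≡ sum f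
  sumFin≡sum {zero}  f = ≡.refl
  sumFin≡sum {suc n} f = ≡.cong (f zero +_) (sumFin≡sum (f ∘ suc))

  sum-≈0 : ∀ {n} {f : Vector Carrier n} → (∀ i → f i ≈ 0#) → sum f ≈ 0#
  sum-≈0 {n} f≈0 = trans (sum-cong-≋ f≈0) (sum-replicate-zero n)

  basis : ∀ {n} → Fin n → Vector Carrier n
  basis zero    zero    = 1#
  basis zero    (suc _) = 0#
  basis (suc _) zero    = 0#
  basis (suc t) (suc s) = basis t s

  sum-basis-* : ∀ {n} (t : Fin n) (a : Vector Carrier n) → sum (λ s → basis t s * a s) ≈ a t
  sum-basis-* zero a = begin
    1# * a zero + sum (λ s → 0# * a (suc s))  ≈⟨ +-cong (*-identityˡ _) (sum-≈0 (λ s → zeroˡ (a (suc s)))) ⟩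
    a zero + 0#                               ≈⟨ +-identityʳ _ ⟩
    a zero                                    ∎
  sum-basis-* (suc t) a = begin
    0# * a zero + sum (λ s → basis t s * a (suc s))  ≈⟨ +-cong (zeroˡ _) (sum-basis-* t (a ∘ suc)) ⟩
    0# + a (suc t)                                   ≈⟨ +-identityˡ _ ⟩
    a (suc t)                                        ∎

  InSpanOn : {I : Set} → (I → Set) → ∀ {m} → (I → Vector Carrier m) → (I → Carrier) → Set
  InSpanOn Q {m} a v = ∃ λ (μ : Vector Carrier m) → ∀ i → Q i → v i ≈ sum (λ t → μ t * a i t)

  module _ {I : Set} {Q : I → Set} {m} {a : I → Vector Carrier m} where

    span-cong : ∀ {u v} → (∀ i → Q i → u i ≈ v i) → InSpanOn Q a u → InSpanOn Q a v
    span-cong u≈v (μ , u≈μa) = μ , λ i q → trans (sym (u≈v i q)) (u≈μa i q)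

    span-0 : InSpanOn Q a (λ _ → 0#)
    span-0 = (λ _ → 0#) , λ i _ → sym (sum-≈0 (λ t → zeroˡ (a i t)))

    span-column : ∀ t → InSpanOn Q a (λ i → a i t)
    span-column t = basis t , λ i _ → sym (sum-basis-* t (a i))

    span-scale : ∀ c {v} → InSpanOn Q a v → InSpanOn Q a (λ i → c * v i)
    span-scale c {v} (μ , v≈μa) = (λ t → c * μ t) , λ i q → begin
      c * v i                            ≈⟨ *-congˡ (v≈μa i q) ⟩
      c * sum (λ t → μ t * a i t)        ≈⟨ *-distribˡ-sum c (λ t → μ t * a i t) ⟩
      sum (λ t → c * (μ t * a i t))      ≈⟨ sum-cong-≋ (λ t → sym (*-assoc c (μ t) (a i t))) ⟩
      sum (λ t → (c * μ t) * a i t)      ∎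

    span-+ : ∀ {u v} → InSpanOn Q a u → InSpanOn Q a v → InSpanOn Q a (λ i → u i + v i)
    span-+ {u} {v} (μ , u≈μa) (ν , v≈νa) = (λ t → μ t + ν t) , λ i q → begin
      u i + v i                                            ≈⟨ +-cong (u≈μa i q) (v≈νa i q) ⟩
      sum (λ t → μ t * a i t) + sum (λ t → ν t * a i t)    ≈⟨ ∑-distrib-+ (λ t → μ t * a i t) (λ t → ν t * a i t) ⟨
      sum (λ t → μ t * a i t + ν t * a i t)                ≈⟨ sum-cong-≋ (λ t → distribʳ (a i t) (μ t) (ν t)) ⟨
      sum (λ t → (μ t + ν t) * a i t)                      ∎

    span-sum : ∀ {n} (w : Fin n → I → Carrier) → (∀ z → InSpanOn Q a (w z)) →
               InSpanOn Q a (λ i → sum (λ z → w z i))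
    span-sum {zero}  w w∈span = span-0
    span-sum {suc n} w w∈span = span-+ (w∈span zero) (span-sum (w ∘ suc) (w∈span ∘ suc))

module _ {𝔽 : FiniteField} (Φ : Template 𝔽) where
  open FiniteField 𝔽 hiding (zero)
  open Template Φ
  open SemiringSum semiring using (sum)
  open SetoidReasoning setoid

  X₁ : (Fin x → Bool) → Fin x → Set
  X₁ P i = P i ≡ true

  Y₁-columns : Fin x → Vector Carrier y₁
  Y₁-columns i t = A₁ i (inj₂ (inj₂ t))

  InY₁SpanOn : (Fin x → Bool) → (Fin x → Carrier) → Set
  InY₁SpanOn P = InSpanOn 𝔽 (X₁ P) Y₁-columns

  Y₁Spans-from-span : ∀ {P} → (∀ j → InY₁SpanOn P (λ i → A₁ i (inj₂ (inj₁ j)))) → Y₁Spans Φ P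
  Y₁Spans-from-span Y₀⊆span j with Y₀⊆span j
  ... | μ , Y₀≈μY₁ = μ , λ i i∈X₁ →
    trans (Y₀≈μY₁ i i∈X₁) (reflexive (≡.sym (sumFin≡sum 𝔽 (λ t → μ t * Y₁-columns i t))))

  Y₀∪Y₁-∉-GroundMinusY₀∪C : ∀ {e} (y : Fin y₀ ⊎ Fin y₁) →
                ¬ (GroundMinusY₀ Φ {e} (inj₁ (inj₂ y)) ⊎ isC Φ {e} (inj₁ (inj₂ y)))
  Y₀∪Y₁-∉-GroundMinusY₀∪C (inj₁ _) (inj₁ (_ , ∉Y₀ , _)) = ∉Y₀ tt
  Y₀∪Y₁-∉-GroundMinusY₀∪C (inj₂ _) (inj₁ (_ , _ , ∉Y₁)) = ∉Y₁ tt

  sumCols-vanishing-on-K : ∀ {e} (f : Cols Φ e → Carrier) → (∀ k → f (inj₁ k) ≈ 0#) →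
                           sumCols Φ f ≈ sum (f ∘ inj₂)
  sumCols-vanishing-on-K f f≈0 = begin
    (sumFin 𝔽 (f ∘ inj₁ ∘ inj₁) + (sumFin 𝔽 (f ∘ inj₁ ∘ inj₂ ∘ inj₁) + sumFin 𝔽 (f ∘ inj₁ ∘ inj₂ ∘ inj₂)))
      + sumFin 𝔽 (f ∘ inj₂)
      ≈⟨ +-cong (+-cong (vanishes inj₁) (+-cong (vanishes (inj₂ ∘ inj₁)) (vanishes (inj₂ ∘ inj₂))))
                (reflexive (sumFin≡sum 𝔽 (f ∘ inj₂))) ⟩
    (0# + (0# + 0#)) + sum (f ∘ inj₂)
      ≈⟨ +-congʳ (trans (+-identityˡ _) (+-identityˡ _)) ⟩
    0# + sum (f ∘ inj₂)
      ≈⟨ +-identityˡ _ ⟩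
    sum (f ∘ inj₂) ∎
    where
    vanishes : ∀ {n} (ι : Fin n → Kₜ Φ) → sumFin 𝔽 (f ∘ inj₁ ∘ ι) ≈ 0#
    vanishes ι = trans (reflexive (sumFin≡sum 𝔽 (f ∘ inj₁ ∘ ι))) (sum-≈0 𝔽 (f≈0 ∘ ι))

  module _ {b e} {A : Matrix Φ b e} where

    conforming-on-X×K : Conforms Φ A → ∀ i k → A (inj₁ i) (inj₁ k) ≈ A₁ i k
    conforming-on-X×K (A' , _ , (A'≈A₁ , _) , A≈A'-on-K , _) i k = trans (A≈A'-on-K (inj₁ i) k) (A'≈A₁ i k)

    conforming-column-in-Y₁-span : ∀ {P} → (∀ l → Λ l → ∀ i → X₁ P i → l i ≈ 0#) → Conforms Φ A →
                                   ∀ z → InY₁SpanOn P (λ i → A (inj₁ i) (inj₂ z))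
    conforming-column-in-Y₁-span Λ-vanishes-on-X₁
      (A' , Z , (A'≈A₁ , A'-on-Z≈0 , _ , _ , A'-off-Z∈Λ , _) , _ , A≈A'-off-Z , A≈A'+Y₁-on-Z) z
        with Z z in Z-at-z
    ... | false = span-cong 𝔽 (λ i i∈X₁ → sym (begin
          A (inj₁ i) (inj₂ z)    ≈⟨ A≈A'-off-Z (inj₁ i) z Z-at-z ⟩
          A' (inj₁ i) (inj₂ z)   ≈⟨ Λ-vanishes-on-X₁ _ (A'-off-Z∈Λ z Z-at-z) i i∈X₁ ⟩
          0#                     ∎))
        (span-0 𝔽)
    ... | true with A≈A'+Y₁-on-Z z Z-at-z
    ...   | j , A≈A'+Y₁ = span-cong 𝔽 (λ i _ → sym (begin
          A (inj₁ i) (inj₂ z)                                        ≈⟨ A≈A'+Y₁ (inj₁ i) ⟩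
          A' (inj₁ i) (inj₂ z) + A' (inj₁ i) (inj₁ (inj₂ (inj₂ j)))  ≈⟨ +-cong (A'-on-Z≈0 i z Z-at-z) (A'≈A₁ i _) ⟩
          0# + Y₁-columns i j                                        ≈⟨ +-identityˡ _ ⟩
          Y₁-columns i j                                             ∎))
        (span-column 𝔽 j)

    spanning-without-Y₀⇒Y₁Spans : ∀ {P} →
      (∀ l → Λ l → ∀ i → X₁ P i → l i ≈ 0#) →
      (∀ i k → X₁ P i → A₁ i (inj₁ k) ≈ 0#) →
      Conforms Φ A → SpanningInMinor Φ A (GroundMinusY₀ Φ) → Y₁Spans Φ P
    spanning-without-Y₀⇒Y₁Spans {P} Λ-vanishes-on-X₁ A₁-vanishes-on-X₁×C A-conforms spanning =
      Y₁Spans-from-span Y₀-column-in-span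
      where
      Y₀-column-in-span : ∀ j → InY₁SpanOn P (λ i → A₁ i (inj₂ (inj₁ j)))
      Y₀-column-in-span j with spanning (inj₁ (inj₂ (inj₁ j))) (λ ()) (λ ())
      ... | μ , μ-outside≈0 , Y₀≈μA = span-cong 𝔽 Y₀-column≈
            (span-sum 𝔽 _ λ z → span-scale 𝔽 (μ (inj₂ z))
              (conforming-column-in-Y₁-span Λ-vanishes-on-X₁ A-conforms z))
        where
        μA-vanishes-on-K : ∀ i → X₁ P i → ∀ k → μ (inj₁ k) * A (inj₁ i) (inj₁ k) ≈ 0#
        μA-vanishes-on-K i i∈X₁ (inj₁ k) = trans
          (*-congˡ (trans (conforming-on-X×K A-conforms i _) (A₁-vanishes-on-X₁×C i k i∈X₁))) (zeroʳ _)
        μA-vanishes-on-K i _ (inj₂ y) = trans (*-congʳ (μ-outside≈0 _ (Y₀∪Y₁-∉-GroundMinusY₀∪C y))) (zeroˡ _)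

        Y₀-column≈ : ∀ i → X₁ P i → sum (λ z → μ (inj₂ z) * A (inj₁ i) (inj₂ z)) ≈ A₁ i (inj₂ (inj₁ j))
        Y₀-column≈ i i∈X₁ = begin
          sum (λ z → μ (inj₂ z) * A (inj₁ i) (inj₂ z))
            ≈⟨ sumCols-vanishing-on-K (λ g → μ g * A (inj₁ i) g) (μA-vanishes-on-K i i∈X₁) ⟨
          sumCols Φ (λ g → μ g * A (inj₁ i) g)          ≈⟨ Y₀≈μA (inj₁ i) ⟨
          A (inj₁ i) (inj₁ (inj₂ (inj₁ j)))             ≈⟨ conforming-on-X×K A-conforms i _ ⟩
          A₁ i (inj₂ (inj₁ j))                          ∎

lemma5p5 : (𝔽 : FiniteField) (Φ : Template 𝔽) → IsReduced Φ → ¬ IsRefined Φ →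
    ∀ {b e : ℕ} (A : Matrix Φ b e) → Conforms Φ A →
    ¬ SpanningInMinor Φ A (GroundMinusY₀ Φ)
lemma5p5 𝔽 Φ (P , reduction@(_ , _ , Λ-vanishes-on-X₁ , A₁-vanishes-on-X₁×C , _))
         not-refined A A-conforms spanning =
  not-refined (P , reduction ,
    spanning-without-Y₀⇒Y₁Spans Φ Λ-vanishes-on-X₁ A₁-vanishes-on-X₁×C A-conforms spanning)
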